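{- Let $A_0=\{f:\mathbb R^3\to\mathbb R \mid f\in C^\infty(\mathbb R^3)\}$ and $A_1=\{\vec f:\mathbb R^3\to\mathbb R^3\mid \vec f\in C^\infty(\mathbb R^3)\}$, and fix a unit vector $\vec e=(e_1,e_2,e_3)\in\mathbb R^3$. Consider the four operators $\nabla_0 f=\sum_{k=1}^3 \frac{\partial f}{\partial x_k}e_k : A_0\to A_0$ (Gateaux directional derivative), $\nabla_1=\mathrm{grad}: A_0\to A_1$, $\nabla_2=\mathrm{curl}: A_1\to A_1$, $\nabla_3=\mathrm{div}: A_1\to A_0$. For $k\ge 1$, let $g(k)$ be the number of sequences $(i_1,\dots,i_k)\in\{0,1,2,3\}^k$ such that the composition $\nabla_{i_k}\circ\cdots\circ\nabla_{i_1}$ is meaningful, i.e. for every $t=1,\dots,k-1$ the codomain of $\nabla_{i_t}$ equals the domain of $\nabla_{i_{t+1}}$. Then $g(k)=2^{k+1}$ for all $k\ge 1$.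
   Context: Equivalently, the composition $\nabla_j\circ\nabla_i$ is meaningful exactly for the pairs $(i,j)\in\{(0,0),(0,1),(1,2),(1,3),(2,2),(2,3),(3,0),(3,1)\}$, and $g(k)$ counts sequences of length $k$ in which every consecutive pair $(i_t,i_{t+1})$ lies in this set. Compositions are counted as formal sequences, including those that are identically zero (e.g. $\mathrm{curl}\,\mathrm{grad}$). -}

module Defs where

open import Data.Nat using (ℕ; zero; suc)
open import Data.Fin using (Fin; zero; suc)
open import Data.Vec using (Vec; []; _∷_)
open import Data.List using (List; []; _∷_; length; filter; concatMap; map)
open import Data.List using (allFin) renaming ([_] to [_]ˡ)
open import Data.Product using (_×_; _,_)
open import Data.Unit using (⊤; tt)
open import Relation.Binary.PropositionalEquality using (_≡_; refl)
open import Relation.Nullary using (Dec; yes; no)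
open import Relation.Nullary.Decidable using (_×-dec_)
open import Relation.Unary using (Decidable)

data Space : Set where
  A₀ A₁ : Space

_≟S_ : (a b : Space) → Dec (a ≡ b)
A₀ ≟S A₀ = yes refl
A₀ ≟S A₁ = no λ ()
A₁ ≟S A₀ = no λ ()
A₁ ≟S A₁ = yes refl

-- Domain and codomain of the operators ∇₀ (directional derivative),
-- ∇₁ = grad, ∇₂ = curl, ∇₃ = div.
dom : Fin 4 → Space
dom zero = A₀
dom (suc zero) = A₀
dom (suc (suc zero)) = A₁
dom (suc (suc (suc zero))) = A₁

cod : Fin 4 → Space
cod zero = A₀
cod (suc zero) = A₁
cod (suc (suc zero)) = A₁
cod (suc (suc (suc zero))) = A₀

Meaningful : ∀ {k} → Vec (Fin 4) k → Set
Meaningful [] = ⊤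
Meaningful (i ∷ []) = ⊤
Meaningful (i ∷ j ∷ is) = (cod i ≡ dom j) × Meaningful (j ∷ is)

meaningful? : ∀ {k} → Decidable (Meaningful {k})
meaningful? [] = yes tt
meaningful? (i ∷ []) = yes tt
meaningful? (i ∷ j ∷ is) = (cod i ≟S dom j) ×-dec meaningful? (j ∷ is)

allSeqs : (k : ℕ) → List (Vec (Fin 4) k)
allSeqs zero = [ [] ]ˡ
allSeqs (suc k) = concatMap (λ i → map (i ∷_) (allSeqs k)) (allFin 4)

g : ℕ → ℕ
g k = length (filter meaningful? (allSeqs k))

-- Every operator ∇ᵢ has exactly two successors: the two operators whose
-- domain is the codomain of ∇ᵢ. Hence, by induction on k, exactly 2ᵏ
-- meaningful sequences of length k + 1 start with any given ∇ᵢ, and summing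
-- over the four possible first operators gives g (k + 1) = 4 · 2ᵏ.
module Submission where

open import Defs
open import Data.Bool using (true; false; if_then_else_)
open import Data.Nat using (ℕ; zero; suc; _+_; _*_; _^_)
open import Data.Nat.Properties using (*-assoc)
open import Data.Nat.ListAction using (sum)
open import Data.Fin using (Fin; zero; suc)
open import Data.Vec using (Vec; _∷_)
open import Data.List using (List; []; _∷_; _++_; length; filter; map; concatMap; allFin)
open import Data.List.Properties using (filter-++; length-++; map-cong)
open import Function using (_∘_)
open import Level using (Level)
open import Relation.Nullary using (Dec; yes; no; does)
open import Relation.Nullary.Decidable using (_×-dec_)
open import Relation.Unary using (Pred; Decidable)
open import Relation.Binary.PropositionalEquality using (_≡_; refl; cong; sym; trans; module ≡-Reasoning)
open ≡-Reasoning

private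
  variable
    a b p q : Level
    A : Set a
    B : Set b

count : {P : Pred A p} → Decidable P → List A → ℕ
count P? xs = length (filter P? xs)

count-++ : {P : Pred A p} (P? : Decidable P) (xs ys : List A) →
           count P? (xs ++ ys) ≡ count P? xs + count P? ys
count-++ P? xs ys = trans (cong length (filter-++ P? xs ys)) (length-++ (filter P? xs))

count-map : {Q : Pred B q} (Q? : Decidable Q) (f : A → B) (xs : List A) →
            count Q? (map f xs) ≡ count (Q? ∘ f) xs
count-map Q? f [] = refl
count-map Q? f (x ∷ xs) with does (Q? (f x))
... | true  = cong suc (count-map Q? f xs)
... | false = count-map Q? f xs

count-concatMap : {Q : Pred B q} (Q? : Decidable Q) (f : A → List B) (xs : List A) →
                  count Q? (concatMap f xs) ≡ sum (map (count Q? ∘ f) xs)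
count-concatMap Q? f [] = refl
count-concatMap Q? f (x ∷ xs) = begin
  count Q? (f x ++ concatMap f xs)          ≡⟨ count-++ Q? (f x) (concatMap f xs) ⟩
  count Q? (f x) + count Q? (concatMap f xs) ≡⟨ cong (count Q? (f x) +_) (count-concatMap Q? f xs) ⟩
  sum (map (count Q? ∘ f) (x ∷ xs))          ∎

count-const-×-dec : {P : Pred A p} {C : Set q} (c? : Dec C) (P? : Decidable P) (xs : List A) →
                    count (λ x → c? ×-dec P? x) xs ≡ (if does c? then count P? xs else 0)
count-const-×-dec (no _)  P? xs = lemma xs
  where
  lemma : ∀ xs → count (λ x → no _ ×-dec P? x) xs ≡ 0
  lemma [] = refl
  lemma (x ∷ xs) = lemma xs
count-const-×-dec (yes c) P? [] = refl
count-const-×-dec (yes c) P? (x ∷ xs) with does (P? x)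
... | true  = cong suc (count-const-×-dec (yes c) P? xs)
... | false = count-const-×-dec (yes c) P? xs

sum-map-const : (n : ℕ) (xs : List A) → sum (map (λ _ → n) xs) ≡ length xs * n
sum-map-const n [] = refl
sum-map-const n (x ∷ xs) = cong (n +_) (sum-map-const n xs)

sum-map-if : {P : Pred A p} (P? : Decidable P) (n : ℕ) (xs : List A) →
             sum (map (λ x → if does (P? x) then n else 0) xs) ≡ count P? xs * n
sum-map-if P? n [] = refl
sum-map-if P? n (x ∷ xs) with does (P? x)
... | true  = cong (n +_) (sum-map-if P? n xs)
... | false = sum-map-if P? n xs

composable? : (i j : Fin 4) → Dec (cod i ≡ dom j)
composable? i j = cod i ≟S dom j

count-composable : (i : Fin 4) → count (composable? i) (allFin 4) ≡ 2
count-composable zero                   = refl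
count-composable (suc zero)             = refl
count-composable (suc (suc zero))       = refl
count-composable (suc (suc (suc zero))) = refl

startingWith : Fin 4 → (k : ℕ) → List (Vec (Fin 4) (suc k))
startingWith i k = map (i ∷_) (allSeqs k)

meaningfulFrom : Fin 4 → ℕ → ℕ
meaningfulFrom i k = count meaningful? (startingWith i k)

g-suc : (k : ℕ) → g (suc k) ≡ sum (map (λ i → meaningfulFrom i k) (allFin 4))
g-suc k = count-concatMap meaningful? (λ i → startingWith i k) (allFin 4)

meaningful-after : (i j : Fin 4) (k : ℕ) →
                   count (meaningful? ∘ (i ∷_)) (startingWith j k)
                     ≡ (if does (composable? i j) then meaningfulFrom j k else 0)
meaningful-after i j k = begin
  count (meaningful? ∘ (i ∷_)) (startingWith j k)
    ≡⟨ count-map (meaningful? ∘ (i ∷_)) (j ∷_) (allSeqs k) ⟩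
  count (λ x → composable? i j ×-dec meaningful? (j ∷ x)) (allSeqs k)
    ≡⟨ count-const-×-dec (composable? i j) (meaningful? ∘ (j ∷_)) (allSeqs k) ⟩
  (if does (composable? i j) then count (meaningful? ∘ (j ∷_)) (allSeqs k) else 0)
    ≡⟨ cong (λ n → if does (composable? i j) then n else 0)
            (sym (count-map meaningful? (j ∷_) (allSeqs k))) ⟩
  (if does (composable? i j) then meaningfulFrom j k else 0) ∎

meaningfulFrom-suc : (i : Fin 4) (k : ℕ) →
                     meaningfulFrom i (suc k)
                       ≡ sum (map (λ j → if does (composable? i j) then meaningfulFrom j k else 0) (allFin 4))
meaningfulFrom-suc i k = begin
  count meaningful? (map (i ∷_) (allSeqs (suc k)))
    ≡⟨ count-map meaningful? (i ∷_) (allSeqs (suc k)) ⟩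
  count (meaningful? ∘ (i ∷_)) (concatMap (λ j → startingWith j k) (allFin 4))
    ≡⟨ count-concatMap (meaningful? ∘ (i ∷_)) (λ j → startingWith j k) (allFin 4) ⟩
  sum (map (λ j → count (meaningful? ∘ (i ∷_)) (startingWith j k)) (allFin 4))
    ≡⟨ cong sum (map-cong (λ j → meaningful-after i j k) (allFin 4)) ⟩
  sum (map (λ j → if does (composable? i j) then meaningfulFrom j k else 0) (allFin 4)) ∎

meaningfulFrom≡2^ : (i : Fin 4) (k : ℕ) → meaningfulFrom i k ≡ 2 ^ k
meaningfulFrom≡2^ i zero = refl
meaningfulFrom≡2^ i (suc k) = begin
  meaningfulFrom i (suc k)
    ≡⟨ meaningfulFrom-suc i k ⟩
  sum (map (λ j → if does (composable? i j) then meaningfulFrom j k else 0) (allFin 4))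
    ≡⟨ cong sum (map-cong (λ j → cong (λ n → if does (composable? i j) then n else 0)
                                      (meaningfulFrom≡2^ j k)) (allFin 4)) ⟩
  sum (map (λ j → if does (composable? i j) then 2 ^ k else 0) (allFin 4))
    ≡⟨ sum-map-if (composable? i) (2 ^ k) (allFin 4) ⟩
  count (composable? i) (allFin 4) * 2 ^ k
    ≡⟨ cong (_* 2 ^ k) (count-composable i) ⟩
  2 ^ suc k ∎

mainTheorem1 : (k : ℕ) → g (suc k) ≡ 2 ^ (suc (suc k))
mainTheorem1 k = begin
  g (suc k)                                            ≡⟨ g-suc k ⟩
  sum (map (λ i → meaningfulFrom i k) (allFin 4))      ≡⟨ cong sum (map-cong (λ i → meaningfulFrom≡2^ i k) (allFin 4)) ⟩
  sum (map (λ _ → 2 ^ k) (allFin 4))                   ≡⟨ sum-map-const (2 ^ k) (allFin 4) ⟩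
  4 * 2 ^ k                                            ≡⟨ *-assoc 2 2 (2 ^ k) ⟩
  2 ^ suc (suc k)                                      ∎
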